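{- Let $(G,\lambda)$ be a temporal graph with $G=(V,E)$ and lifetime $T$, and let $\Delta\le T$. Let $2\le t\le T-\Delta+1$ and let $A_1,\dots,A_\Delta\subseteq V$ be such that $\bigcup_{i=1}^{\Delta}(A_i,t+i-1)$ is a temporal vertex cover of $(G,\lambda)|_{[t,t+\Delta-1]}$. Then $$f(t;A_1,\dots,A_\Delta)=|A_\Delta|+\min_{X\subseteq V} f(t-1;X,A_1,\dots,A_{\Delta-1}).$$
   Context: A temporal graph is a pair $(G,\lambda)$ where $G=(V,E)$ is a finite simple undirected graph and $\lambda:E\to 2^{\mathbb{N}}$ assigns to every edge a finite nonempty set of positive integer time labels; the lifetime is $T=\max\{t:t\in\lambda(e),e\in E\}$; $E_t=\{e:t\in\lambda(e)\}$. A vertex appearance is a pair $(v,s)$, $v\in V$, $s\in\{1,\dots,T\}$; it temporally covers edge $e$ if $v$ is an endpoint of $e$ and $s\in\lambda(e)$. For $S\subseteq V$, $(S,s)=\{(v,s):v\in S\}$; for a set $\mathcal{S}$ of vertex appearances, $\mathcal{S}_s=\{(v,s)\in\mathcal{S}\}$. For $1\le i\le j\le T$, $(G,\lambda)|_{[i,j]}$ is the temporal graph consisting of the snapshots $G_i,\dots,G_j$ (edges with their labels in $\{i,\dots,j\}$), and a temporal vertex cover of it is a set of vertex appearances with times in $\{i,\dots,j\}$ temporally covering every edge active at some time in $\{i,\dots,j\}$. For $\Delta\le j$, a sliding $\Delta$-window temporal vertex cover of $(G,\lambda)|_{[1,j]}$ is a set $\mathcal{S}$ of vertex appearances with times in $\{1,\dots,j\}$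 such that for every $s\in\{1,\dots,j-\Delta+1\}$ and every edge $e$ active at some time in $W_s=\{s,\dots,s+\Delta-1\}$, some $(w,r)\in\mathcal{S}$ with $r\in W_s$ temporally covers $e$. For $t\in\{1,\dots,T-\Delta+1\}$ and $A_1,\dots,A_\Delta\subseteq V$, $f(t;A_1,\dots,A_\Delta)$ is the minimum cardinality of a sliding $\Delta$-window temporal vertex cover $\mathcal{S}$ of $(G,\lambda)|_{[1,t+\Delta-1]}$ with $\mathcal{S}_{t+i-1}=(A_i,t+i-1)$ for all $i=1,\dots,\Delta$, and $f(t;A_1,\dots,A_\Delta)=\infty$ if no such $\mathcal{S}$ exists (with the conventions $\min$ of a set containing only $\infty$ is $\infty$ and $a+\infty=\infty$). -}

module Defs where

open import Data.Bool using (Bool; true; false; _∧_; _∨_; not; if_then_else_)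
open import Data.Nat using (ℕ; zero; suc; _+_; _∸_; _≤_; _<ᵇ_; _⊓_)
open import Data.Fin using (Fin; toℕ)
open import Data.Fin.Subset using (Subset; ⊥; ∣_∣)
open import Data.List using (List; []; _∷_; map; upTo; allFin; concatMap; foldr)
open import Data.Bool.ListAction using (all; any)
open import Data.Vec using (Vec; []; _∷_; lookup)
open import Data.Vec.Properties using (≡-dec)
import Data.Bool.Properties as BP
open import Data.Product using (Σ; _×_; _,_)
open import Relation.Binary.PropositionalEquality using (_≡_)
open import Relation.Nullary.Decidable using (⌊_⌋)

-- Vertices are Fin n.  active u v t = true  iff  {u,v} ∈ E and t ∈ λ({u,v}).
-- The underlying graph G has as edges exactly the pairs with a nonempty
-- label set (every edge has a nonempty finite set of positive labels).
record TemporalGraph : Set where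
  field
    n      : ℕ
    T      : ℕ
    active : Fin n → Fin n → ℕ → Bool
    sym    : ∀ u v t → active u v t ≡ active v u t
    irrefl : ∀ u t → active u u t ≡ false
    labels-positive : ∀ u v t → active u v t ≡ true → 1 ≤ t
    labels-≤T       : ∀ u v t → active u v t ≡ true → t ≤ T
    lifetime        : Σ (Fin n) λ u → Σ (Fin n) λ v → active u v T ≡ true
open TemporalGraph public

-- extended naturals (∞ for infeasible)
data ℕ∞ : Set where
  fin : ℕ → ℕ∞
  ∞   : ℕ∞

_⊓∞_ : ℕ∞ → ℕ∞ → ℕ∞
fin a ⊓∞ fin b = fin (a ⊓ b)
fin a ⊓∞ ∞     = fin a
∞     ⊓∞ y     = y

_+∞_ : ℕ∞ → ℕ∞ → ℕ∞
fin a +∞ fin b = fin (a + b)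
_     +∞ _     = ∞

minList : List ℕ∞ → ℕ∞
minList = foldr _⊓∞_ ∞

-- the list [a, a+1, ..., b]  (empty if b < a)
interval : ℕ → ℕ → List ℕ
interval a b = map (a +_) (upTo (suc b ∸ a))

-- Sets of vertex appearances are given by their time slices:
-- S : ℕ → Subset n, with S s = the set of v such that (v,s) ∈ S.

module _ (G : TemporalGraph) where

  -- is the set S (restricted to times in [a,b]) a temporal vertex cover
  -- of (G,λ)|[a,b]?
  isTVC : (ℕ → Subset (n G)) → ℕ → ℕ → Bool
  isTVC S a b =
    all (λ u → all (λ v →
        not (any (active G u v) (interval a b))
      ∨ any (λ r → active G u v r ∧ (lookup (S r) u ∨ lookup (S r) v)) (interval a b))
      (allFin (n G))) (allFin (n G))

  isSlidingTVC : ℕ → ℕ → (ℕ → Subset (n G)) → Bool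
  isSlidingTVC Δ j S = all (λ s → isTVC S s (s + Δ ∸ 1)) (interval 1 (j + 1 ∸ Δ))

  -- A set of vertex appearances with times in {1,…,j}, given by the vector
  -- of its slices at times 1,…,j.
  -- at xs r = slice at time r (1-based); empty outside {1,…,j}.
  at : ∀ {j} → Vec (Subset (n G)) j → ℕ → Subset (n G)
  at []       _             = ⊥
  at (x ∷ xs) zero          = ⊥
  at (x ∷ xs) (suc zero)    = x
  at (x ∷ xs) (suc (suc r)) = at xs (suc r)

  -- the set ⋃_{i=1}^{k} (A_i, t+i-1) as a slice function
  placeAt : ∀ {k} → ℕ → Vec (Subset (n G)) k → ℕ → Subset (n G)
  placeAt t A r = if r <ᵇ t then ⊥ else at A (suc (r ∸ t))

  card : ∀ {j} → Vec (Subset (n G)) j → ℕ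
  card []       = 0
  card (x ∷ xs) = ∣ x ∣ + card xs

  allSubsets : (m : ℕ) → List (Subset m)
  allSubsets zero    = [] ∷ []
  allSubsets (suc m) = concatMap (λ s → (true ∷ s) ∷ (false ∷ s) ∷ []) (allSubsets m)

  allAppearanceSets : (j : ℕ) → List (Vec (Subset (n G)) j)
  allAppearanceSets zero    = [] ∷ []
  allAppearanceSets (suc j) =
    concatMap (λ x → map (x ∷_) (allAppearanceSets j)) (allSubsets (n G))

  -- S_{t+i-1} = (A_i, t+i-1) for all i = 1..Δ   (0-based i here)
  agrees : ∀ {Δ j} → ℕ → Vec (Subset (n G)) Δ → Vec (Subset (n G)) j → Bool
  agrees {Δ} t A S =
    all (λ i → ⌊ ≡-dec BP._≟_ (at S (t + toℕ i)) (lookup A i) ⌋) (allFin Δ)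

  -- f(t; A_1,…,A_Δ): minimum cardinality of a sliding Δ-window temporal
  -- vertex cover S of (G,λ)|[1,t+Δ-1] with S_{t+i-1} = (A_i,t+i-1); ∞ if none.
  f : (Δ t : ℕ) → Vec (Subset (n G)) Δ → ℕ∞
  f Δ t A = minList (map (λ S →
      if isSlidingTVC Δ (t + Δ ∸ 1) (at S) ∧ agrees t A S
      then fin (card S) else ∞)
    (allAppearanceSets (t + Δ ∸ 1)))

module Submission where

-- Write t = u + 2 and Δ = d + 1.  Call a vector S of slices at the times
-- 1,…,t+Δ-1 feasible for (t, A) when it covers the first t sliding windows
-- and agrees with A_1,…,A_Δ at the times t,…,t+Δ-1; then f(t;A) is the least
-- cardinality of a feasible vector.  The recursion rests on a one-step
-- correspondence: the feasible vectors for (t, A) are exactly the vectors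
-- S' ∷ʳ A_Δ with S' feasible for (t-1, X ∷ A_1,…,A_{Δ-1}), where X is the
-- slice of S' at time t-1.  Indeed the windows 1,…,t-1 only look at times
-- ≤ t+Δ-2, while the last window t is covered because S agrees with A there
-- (the hypothesis of the theorem).  As |S' ∷ʳ A_Δ| = |A_Δ| + |S'|, each side
-- of the equation bounds the other.

open import Defs hiding (sym)
open import Data.Nat using (ℕ; zero; suc; _+_; _∸_; _≤_; _<_; z≤n; s≤s; _<ᵇ_)
open import Data.Nat.Properties
open import Data.Fin using (Fin; toℕ; fromℕ<)
open import Data.Fin.Properties using (toℕ-fromℕ<; toℕ<n)
open import Data.Fin.Subset using (Subset; ∣_∣)
open import Data.Vec using (Vec; []; _∷_; init; last; _∷ʳ_; lookup; initLast)
open import Data.List using ([]; _∷_; map; allFin)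
open import Data.List.Properties using (map-cong-local)
open import Data.List.Membership.Propositional using (_∈_; lose)
open import Data.List.Membership.Propositional.Properties
  using (∈-map⁺; ∈-map⁻; ∈-upTo⁺; ∈-upTo⁻; ∈-concatMap⁺; ∈-allFin)
open import Data.List.Relation.Unary.Any using (here; there)
import Data.List.Relation.Unary.All as All
open import Data.List.Relation.Unary.All.Properties using (all⁺; all⁻)
open import Data.Bool using (Bool; true; false; _∧_; _∨_; not; if_then_else_)
open import Data.Bool.ListAction using (all; any; and; or)
open import Data.Bool.Properties using (T-≡; ∧-conicalˡ; ∧-conicalʳ)
open import Data.Product using (_×_; _,_; proj₂)
open import Data.Sum using (inj₁; inj₂)
open import Function.Bundles using (Equivalence)
open import Relation.Binary.PropositionalEquality
  using (_≡_; refl; sym; trans; cong; cong₂; subst; module ≡-Reasoning)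
open import Relation.Nullary using (Dec)
open import Relation.Nullary.Decidable using (⌊_⌋; toWitness; fromWitness)

all-true⇒ : ∀ {A : Set} (p : A → Bool) xs →
            all p xs ≡ true → ∀ {x} → x ∈ xs → p x ≡ true
all-true⇒ p xs e x∈xs =
  Equivalence.to T-≡ (All.lookup (all⁺ p xs (Equivalence.from T-≡ e)) x∈xs)

all-true⇐ : ∀ {A : Set} (p : A → Bool) xs →
            (∀ {x} → x ∈ xs → p x ≡ true) → all p xs ≡ true
all-true⇐ p xs h =
  Equivalence.to T-≡ (all⁻ p (All.tabulate (λ x∈xs → Equivalence.from T-≡ (h x∈xs))))

all-cong : ∀ {A : Set} {p q : A → Bool} xs →
           (∀ {x} → x ∈ xs → p x ≡ q x) → all p xs ≡ all q xs
all-cong xs h = cong and (map-cong-local (All.tabulate h))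

any-cong : ∀ {A : Set} {p q : A → Bool} xs →
           (∀ {x} → x ∈ xs → p x ≡ q x) → any p xs ≡ any q xs
any-cong xs h = cong or (map-cong-local (All.tabulate h))

isYes-sound : ∀ {P : Set} {p? : Dec P} → ⌊ p? ⌋ ≡ true → P
isYes-sound e = toWitness (Equivalence.from T-≡ e)

isYes-complete : ∀ {P : Set} {p? : Dec P} → P → ⌊ p? ⌋ ≡ true
isYes-complete p = Equivalence.to T-≡ (fromWitness p)

if-true : ∀ {A : Set} {b} {x y : A} → b ≡ true → (if b then x else y) ≡ x
if-true refl = refl

≤⇒<ᵇ-false : ∀ {t r} → t ≤ r → (r <ᵇ t) ≡ false
≤⇒<ᵇ-false z≤n     = refl
≤⇒<ᵇ-false (s≤s p) = ≤⇒<ᵇ-false p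

offset-bound : ∀ a b k → k < suc b ∸ a → a + k ≤ b
offset-bound zero    b       k (s≤s k≤b) = k≤b
offset-bound (suc a) zero    k k<0 rewrite 0∸n≡0 a with k<0
... | ()
offset-bound (suc a) (suc b) k k<       = s≤s (offset-bound a b k k<)

interval-bounds : ∀ {a b r} → r ∈ interval a b → a ≤ r × r ≤ b
interval-bounds {a} {b} r∈ with ∈-map⁻ (a +_) r∈
... | k , k∈ , refl = m≤m+n a k , offset-bound a b k (∈-upTo⁻ k∈)

interval-complete : ∀ {a b r} → a ≤ r → r ≤ b → r ∈ interval a b
interval-complete {a} {b} a≤r r≤b =
  subst (_∈ interval a b) (m+[n∸m]≡n a≤r)
        (∈-map⁺ (a +_) (∈-upTo⁺ (∸-monoˡ-< (s≤s r≤b) a≤r)))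

infix 4 _≤∞_
data _≤∞_ : ℕ∞ → ℕ∞ → Set where
  fin≤fin : ∀ {a b} → a ≤ b → fin a ≤∞ fin b
  ≤∞-top  : ∀ {x} → x ≤∞ ∞

≤∞-refl : ∀ {x} → x ≤∞ x
≤∞-refl {fin a} = fin≤fin ≤-refl
≤∞-refl {∞}     = ≤∞-top

≤∞-trans : ∀ {x y z} → x ≤∞ y → y ≤∞ z → x ≤∞ z
≤∞-trans (fin≤fin p) (fin≤fin q) = fin≤fin (≤-trans p q)
≤∞-trans _           ≤∞-top      = ≤∞-top

≤∞-antisym : ∀ {x y} → x ≤∞ y → y ≤∞ x → x ≡ y
≤∞-antisym (fin≤fin p) (fin≤fin q) = cong fin (≤-antisym p q)
≤∞-antisym ≤∞-top      ≤∞-top      = refl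

⊓∞-lowerˡ : ∀ x y → x ⊓∞ y ≤∞ x
⊓∞-lowerˡ (fin a) (fin b) = fin≤fin (m⊓n≤m a b)
⊓∞-lowerˡ (fin a) ∞       = ≤∞-refl
⊓∞-lowerˡ ∞       y       = ≤∞-top

⊓∞-lowerʳ : ∀ x y → x ⊓∞ y ≤∞ y
⊓∞-lowerʳ (fin a) (fin b) = fin≤fin (m⊓n≤n a b)
⊓∞-lowerʳ (fin a) ∞       = ≤∞-top
⊓∞-lowerʳ ∞       y       = ≤∞-refl

+∞-monoʳ : ∀ c {x y} → x ≤∞ y → fin c +∞ x ≤∞ fin c +∞ y
+∞-monoʳ c (fin≤fin p) = fin≤fin (+-monoʳ-≤ c p)
+∞-monoʳ c ≤∞-top      = ≤∞-top

+∞-identityˡ : ∀ x → fin 0 +∞ x ≡ x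
+∞-identityˡ (fin a) = refl
+∞-identityˡ ∞       = refl

⊓∞-glb+ : ∀ c {m} x y → m ≤∞ fin c +∞ x → m ≤∞ fin c +∞ y → m ≤∞ fin c +∞ (x ⊓∞ y)
⊓∞-glb+ c (fin a) (fin b) (fin≤fin p) (fin≤fin q) =
  fin≤fin (subst (_ ≤_) (sym (+-distribˡ-⊓ c a b)) (⊓-glb p q))
⊓∞-glb+ c (fin a) ∞ p _ = p
⊓∞-glb+ c ∞       y _ q = q

minList-lower : ∀ {A : Set} (g : A → ℕ∞) xs {x} → x ∈ xs → minList (map g xs) ≤∞ g x
minList-lower g (x ∷ xs) (here refl) = ⊓∞-lowerˡ (g x) _
minList-lower g (y ∷ xs) (there x∈) = ≤∞-trans (⊓∞-lowerʳ (g y) _) (minList-lower g xs x∈)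

minList-greatest+ : ∀ {A : Set} c {m} (g : A → ℕ∞) xs →
                    (∀ {x} → x ∈ xs → m ≤∞ fin c +∞ g x) → m ≤∞ fin c +∞ minList (map g xs)
minList-greatest+ c g []       h = ≤∞-top
minList-greatest+ c g (x ∷ xs) h =
  ⊓∞-glb+ c (g x) _ (h (here refl)) (minList-greatest+ c g xs (λ x∈ → h (there x∈)))

module Feasibility (G : TemporalGraph) where

  Slice : Set
  Slice = Subset (n G)

  at-∷ʳ : ∀ {m} (S : Vec Slice m) x r → r ≤ m → at G (S ∷ʳ x) r ≡ at G S r
  at-∷ʳ []      x zero          _       = refl
  at-∷ʳ (y ∷ S) x zero          _       = refl
  at-∷ʳ (y ∷ S) x (suc zero)    _       = refl
  at-∷ʳ (y ∷ S) x (suc (suc r)) (s≤s p) = at-∷ʳ S x (suc r) p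

  at-∷ʳ-last : ∀ {m} (S : Vec Slice m) x → at G (S ∷ʳ x) (suc m) ≡ x
  at-∷ʳ-last []      x = refl
  at-∷ʳ-last (y ∷ S) x = at-∷ʳ-last S x

  card-∷ʳ : ∀ {m} (S : Vec Slice m) x → card G (S ∷ʳ x) ≡ card G S + ∣ x ∣
  card-∷ʳ []      x = +-comm ∣ x ∣ 0
  card-∷ʳ (y ∷ S) x = trans (cong (∣ y ∣ +_) (card-∷ʳ S x)) (sym (+-assoc ∣ y ∣ _ _))

  at-init : ∀ {m} (S : Vec Slice (suc m)) r → r ≤ m → at G S r ≡ at G (init S) r
  at-init S r r≤m =
    trans (cong (λ Z → at G Z r) (proj₂ (proj₂ (initLast S)))) (at-∷ʳ (init S) (last S) r r≤m)

  at-last : ∀ {m} (S : Vec Slice (suc m)) → at G S (suc m) ≡ last S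
  at-last {m} S =
    trans (cong (λ Z → at G Z (suc m)) (proj₂ (proj₂ (initLast S)))) (at-∷ʳ-last (init S) (last S))

  lookup-at : ∀ {k} (A : Vec Slice k) i → lookup A i ≡ at G A (suc (toℕ i))
  lookup-at (x ∷ A) Fin.zero    = refl
  lookup-at (x ∷ A) (Fin.suc i) = lookup-at A i

  subsets-complete : ∀ m (x : Subset m) → x ∈ allSubsets G m
  subsets-complete zero    []          = here refl
  subsets-complete (suc m) (true ∷ x)  =
    ∈-concatMap⁺ (λ s → (true ∷ s) ∷ (false ∷ s) ∷ []) (lose (subsets-complete m x) (here refl))
  subsets-complete (suc m) (false ∷ x) =
    ∈-concatMap⁺ (λ s → (true ∷ s) ∷ (false ∷ s) ∷ []) (lose (subsets-complete m x) (there (here refl)))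

  appearances-complete : ∀ j (S : Vec Slice j) → S ∈ allAppearanceSets G j
  appearances-complete zero    []      = here refl
  appearances-complete (suc j) (x ∷ S) =
    ∈-concatMap⁺ (λ y → map (y ∷_) (allAppearanceSets G j))
      (lose (subsets-complete (n G) x) (∈-map⁺ (x ∷_) (appearances-complete j S)))

  isTVC-cong : ∀ (S S' : ℕ → Slice) a b →
               (∀ r → a ≤ r → r ≤ b → S r ≡ S' r) → isTVC G S a b ≡ isTVC G S' a b
  isTVC-cong S S' a b h = all-cong (allFin (n G)) λ {u} _ → all-cong (allFin (n G)) λ {v} _ →
    cong (not (any (active G u v) (interval a b)) ∨_) (any-cong (interval a b) λ {r} r∈ →
      let a≤r , r≤b = interval-bounds r∈
      in cong (λ Z → active G u v r ∧ (lookup Z u ∨ lookup Z v)) (h r a≤r r≤b))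

  Covers : ℕ → ℕ → (ℕ → Slice) → Set
  Covers Δ w S = ∀ s → 1 ≤ s → s ≤ w → isTVC G S s (s + Δ ∸ 1) ≡ true

  covers-sound : ∀ Δ j S → isSlidingTVC G Δ j S ≡ true → Covers Δ (j + 1 ∸ Δ) S
  covers-sound Δ j S e s 1≤s s≤w = all-true⇒ _ (interval 1 (j + 1 ∸ Δ)) e (interval-complete 1≤s s≤w)

  covers-complete : ∀ Δ j S → Covers Δ (j + 1 ∸ Δ) S → isSlidingTVC G Δ j S ≡ true
  covers-complete Δ j S cov = all-true⇐ _ (interval 1 (j + 1 ∸ Δ)) λ s∈ →
    let 1≤s , s≤w = interval-bounds s∈ in cov _ 1≤s s≤w

  covers-cong : ∀ {Δ w} {S S' : ℕ → Slice} →
                (∀ r → r ≤ w + Δ ∸ 1 → S r ≡ S' r) → Covers Δ w S → Covers Δ w S'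
  covers-cong {Δ} {w} {S} {S'} eq cov s 1≤s s≤w =
    trans (sym (isTVC-cong S S' s (s + Δ ∸ 1) (λ r _ r≤ → eq r (≤-trans r≤ window-end≤))))
          (cov s 1≤s s≤w)
    where
    window-end≤ : s + Δ ∸ 1 ≤ w + Δ ∸ 1
    window-end≤ = ∸-monoˡ-≤ 1 (+-monoˡ-≤ Δ s≤w)

  covers-pred : ∀ {Δ w S} → Covers Δ (suc w) S → Covers Δ w S
  covers-pred cov s 1≤s s≤w = cov s 1≤s (m≤n⇒m≤1+n s≤w)

  covers-extend : ∀ {Δ w S} → Covers Δ w S →
                  isTVC G S (suc w) (suc w + Δ ∸ 1) ≡ true → Covers Δ (suc w) S
  covers-extend cov last-window s 1≤s s≤1+w with m≤n⇒m<n∨m≡n s≤1+w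
  ... | inj₁ (s≤s s≤w) = cov s 1≤s s≤w
  ... | inj₂ refl      = last-window

  -- A sliding cover of [1, t+Δ-1] consists of exactly t windows.
  window-count : ∀ t d → t + suc d ∸ 1 + 1 ∸ suc d ≡ t
  window-count t d = begin
    t + suc d ∸ 1 + 1 ∸ suc d  ≡⟨ cong (λ j → j + 1 ∸ suc d) (cong (_∸ 1) (+-suc t d)) ⟩
    t + d + 1 ∸ suc d          ≡⟨ cong (_∸ suc d) (+-comm (t + d) 1) ⟩
    t + d ∸ d                  ≡⟨ m+n∸n≡m t d ⟩
    t                          ∎
    where open ≡-Reasoning

  Agrees : ∀ {Δ j} → ℕ → Vec Slice Δ → Vec Slice j → Set
  Agrees {Δ} t A S = ∀ k → k < Δ → at G S (t + k) ≡ at G A (suc k)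

  agrees-sound : ∀ {Δ j} t (A : Vec Slice Δ) (S : Vec Slice j) → agrees G t A S ≡ true → Agrees t A S
  agrees-sound {Δ} t A S e k k<Δ =
    subst (λ z → at G S (t + z) ≡ at G A (suc z)) (toℕ-fromℕ< k<Δ)
      (trans (isYes-sound (all-true⇒ _ (allFin Δ) e (∈-allFin i))) (lookup-at A i))
    where i = fromℕ< k<Δ

  agrees-complete : ∀ {Δ j} t (A : Vec Slice Δ) (S : Vec Slice j) → Agrees t A S → agrees G t A S ≡ true
  agrees-complete {Δ} t A S ag = all-true⇐ _ (allFin Δ) λ {i} _ →
    isYes-complete (trans (ag (toℕ i) (toℕ<n i)) (sym (lookup-at A i)))

  -- Agreeing with A on [t, t+d] means coinciding there with ⋃ (A_i, t+i-1), so the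
  -- hypothesis of the theorem makes the window starting at t covered.
  agrees-window : ∀ {d j} t (A : Vec Slice (suc d)) (S : Vec Slice j) → Agrees t A S →
                  isTVC G (placeAt G t A) t (t + d) ≡ true → isTVC G (at G S) t (t + suc d ∸ 1) ≡ true
  agrees-window {d} t A S ag cover =
    trans (isTVC-cong (at G S) (placeAt G t A) t (t + suc d ∸ 1) coincide)
          (subst (λ e → isTVC G (placeAt G t A) t e ≡ true) (sym (cong (_∸ 1) (+-suc t d))) cover)
    where
    coincide : ∀ r → t ≤ r → r ≤ t + suc d ∸ 1 → at G S r ≡ placeAt G t A r
    coincide r t≤r r≤ rewrite ≤⇒<ᵇ-false {t} {r} t≤r =
      trans (cong (at G S) (sym (m+[n∸m]≡n t≤r)))
            (ag (r ∸ t) (s≤s (m≤n+o⇒m∸n≤o r t (subst (r ≤_) (cong (_∸ 1) (+-suc t d)) r≤))))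

  Feasible : (d t : ℕ) → Vec Slice (suc d) → Vec Slice (t + suc d ∸ 1) → Set
  Feasible d t A S = Covers (suc d) t (at G S) × Agrees t A S

  feasible-sound : ∀ d t A S →
    (isSlidingTVC G (suc d) (t + suc d ∸ 1) (at G S) ∧ agrees G t A S) ≡ true → Feasible d t A S
  feasible-sound d t A S e =
    let sliding = isSlidingTVC G (suc d) (t + suc d ∸ 1) (at G S) in
    subst (λ w → Covers (suc d) w (at G S)) (window-count t d)
          (covers-sound (suc d) (t + suc d ∸ 1) (at G S) (∧-conicalˡ sliding _ e)) ,
    agrees-sound t A S (∧-conicalʳ sliding _ e)

  feasible-complete : ∀ d t A S → Feasible d t A S →
    (isSlidingTVC G (suc d) (t + suc d ∸ 1) (at G S) ∧ agrees G t A S) ≡ true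
  feasible-complete d t A S (cov , ag) =
    cong₂ _∧_ (covers-complete (suc d) (t + suc d ∸ 1) (at G S)
                 (subst (λ w → Covers (suc d) w (at G S)) (sym (window-count t d)) cov))
              (agrees-complete t A S ag)

  -- f is a lower bound for the cardinalities of feasible vectors ...
  f-≤ : ∀ d t A S → Feasible d t A S → f G (suc d) t A ≤∞ fin (card G S)
  f-≤ d t A S F =
    subst (f G (suc d) t A ≤∞_) (if-true (feasible-complete d t A S F))
          (minList-lower _ (allAppearanceSets G (t + suc d ∸ 1)) (appearances-complete _ S))

  -- ... and the greatest one (stated after adding a constant c, as needed for
  -- the right-hand side of the theorem).
  f-greatest+ : ∀ d t A c {m} → (∀ S → Feasible d t A S → m ≤∞ fin (c + card G S)) →
                m ≤∞ fin c +∞ f G (suc d) t A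
  f-greatest+ d t A c {m} h =
    minList-greatest+ c _ (allAppearanceSets G (t + suc d ∸ 1)) (λ {S} _ → bound S)
    where
    bound : ∀ S → m ≤∞ fin c +∞ (if isSlidingTVC G (suc d) (t + suc d ∸ 1) (at G S) ∧ agrees G t A S
                                 then fin (card G S) else ∞)
    bound S with isSlidingTVC G (suc d) (t + suc d ∸ 1) (at G S) ∧ agrees G t A S in e
    ... | true  = h S (feasible-sound d t A S e)
    ... | false = ≤∞-top

  -- The one-step correspondence between times t - 1 = u + 1 and t = u + 2.
  -- In a vector of length t+Δ-1 = (u + (d+1)) + 1, the times before the
  -- last one are t + k for k < d, and the last one is t + d.

  shift : ∀ u k → suc u + suc k ≡ suc (suc u) + k
  shift u k = cong suc (+-suc u k)

  last-time : ∀ u d → suc (suc u) + d ≡ suc (u + suc d)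
  last-time u d = cong suc (sym (+-suc u d))

  inner-time : ∀ u {d k} → k < d → suc (suc u) + k ≤ u + suc d
  inner-time u {d} {k} k<d = begin
    suc (suc u) + k  ≡⟨ sym (shift u k) ⟩
    suc u + suc k    ≤⟨ +-monoʳ-≤ (suc u) k<d ⟩
    suc u + d        ≡⟨ sym (+-suc u d) ⟩
    u + suc d        ∎
    where open ≤-Reasoning

  agrees-∷ʳ : ∀ {d u} (A : Vec Slice (suc d)) X (S' : Vec Slice (u + suc d)) →
              Agrees (suc u) (X ∷ init A) S' → Agrees (suc (suc u)) A (S' ∷ʳ last A)
  agrees-∷ʳ {d} {u} A X S' ag k k<Δ with m≤n⇒m<n∨m≡n (≤-pred k<Δ)
  ... | inj₁ k<d = begin
    at G (S' ∷ʳ last A) (suc (suc u) + k)  ≡⟨ at-∷ʳ S' (last A) _ (inner-time u k<d) ⟩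
    at G S' (suc (suc u) + k)              ≡⟨ cong (at G S') (sym (shift u k)) ⟩
    at G S' (suc u + suc k)                ≡⟨ ag (suc k) (s≤s k<d) ⟩
    at G (init A) (suc k)                  ≡⟨ sym (at-init A (suc k) k<d) ⟩
    at G A (suc k)                         ∎
    where open ≡-Reasoning
  ... | inj₂ refl = begin
    at G (S' ∷ʳ last A) (suc (suc u) + d)   ≡⟨ cong (at G (S' ∷ʳ last A)) (last-time u d) ⟩
    at G (S' ∷ʳ last A) (suc (u + suc d))   ≡⟨ at-∷ʳ-last S' (last A) ⟩
    last A                                  ≡⟨ sym (at-last A) ⟩
    at G A (suc d)                          ∎
    where open ≡-Reasoning

  agrees-init : ∀ {d u} (A : Vec Slice (suc d)) (S' : Vec Slice (u + suc d)) x →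
                Agrees (suc (suc u)) A (S' ∷ʳ x) → Agrees (suc u) (at G S' (suc u) ∷ init A) S'
  agrees-init {d} {u} A S' x ag zero    _         = cong (at G S') (+-identityʳ (suc u))
  agrees-init {d} {u} A S' x ag (suc k) (s≤s k<d) = begin
    at G S' (suc u + suc k)             ≡⟨ cong (at G S') (shift u k) ⟩
    at G S' (suc (suc u) + k)           ≡⟨ sym (at-∷ʳ S' x _ (inner-time u k<d)) ⟩
    at G (S' ∷ʳ x) (suc (suc u) + k)    ≡⟨ ag k (m<n⇒m<1+n k<d) ⟩
    at G A (suc k)                      ≡⟨ at-init A (suc k) k<d ⟩
    at G (init A) (suc k)               ∎
    where open ≡-Reasoning

  agrees-last : ∀ {d u} (A : Vec Slice (suc d)) (S' : Vec Slice (u + suc d)) x →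
                Agrees (suc (suc u)) A (S' ∷ʳ x) → x ≡ last A
  agrees-last {d} {u} A S' x ag = begin
    x                                   ≡⟨ sym (at-∷ʳ-last S' x) ⟩
    at G (S' ∷ʳ x) (suc (u + suc d))    ≡⟨ cong (at G (S' ∷ʳ x)) (sym (last-time u d)) ⟩
    at G (S' ∷ʳ x) (suc (suc u) + d)    ≡⟨ ag d ≤-refl ⟩
    at G A (suc d)                      ≡⟨ at-last A ⟩
    last A                              ∎
    where open ≡-Reasoning

  feasible-∷ʳ : ∀ {d u} (A : Vec Slice (suc d)) X (S' : Vec Slice (u + suc d)) →
                isTVC G (placeAt G (suc (suc u)) A) (suc (suc u)) (suc (suc u) + d) ≡ true →
                Feasible d (suc u) (X ∷ init A) S' → Feasible d (suc (suc u)) A (S' ∷ʳ last A)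
  feasible-∷ʳ A X S' cover (cov , ag) =
    covers-extend {S = at G (S' ∷ʳ last A)} (covers-cong {S = at G S'} {S' = at G (S' ∷ʳ last A)} (λ r r≤ → sym (at-∷ʳ S' (last A) r r≤)) cov)
                  (agrees-window _ A (S' ∷ʳ last A) ag∷ʳ cover) ,
    ag∷ʳ
    where
    ag∷ʳ = agrees-∷ʳ A X S' ag

  feasible-init : ∀ {d u} (A : Vec Slice (suc d)) (S' : Vec Slice (u + suc d)) x →
                  Feasible d (suc (suc u)) A (S' ∷ʳ x) →
                  x ≡ last A × Feasible d (suc u) (at G S' (suc u) ∷ init A) S'
  feasible-init A S' x (cov , ag) =
    agrees-last A S' x ag ,
    (covers-cong {S = at G (S' ∷ʳ x)} {S' = at G S'} (λ r r≤ → at-∷ʳ S' x r r≤) (covers-pred {S = at G (S' ∷ʳ x)} cov) , agrees-init A S' x ag)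

lemma2 : (G : TemporalGraph) (d : ℕ) → suc d ≤ T G →
    (t : ℕ) → 2 ≤ t → t + suc d ≤ T G + 1 →
    (A : Vec (Subset (n G)) (suc d)) →
    isTVC G (placeAt G t A) t (t + d) ≡ true →
    f G (suc d) t A
    ≡ fin ∣ last A ∣ +∞ minList (map (λ X → f G (suc d) (t ∸ 1) (X ∷ init A)) (allSubsets G (n G)))
lemma2 G d _ (suc (suc u)) (s≤s (s≤s z≤n)) _ A cover = ≤∞-antisym lhs≤rhs rhs≤lhs
  where
  open Feasibility G
  c = ∣ last A ∣

  previous : Slice → ℕ∞
  previous X = f G (suc d) (suc u) (X ∷ init A)

  -- every feasible vector for t - 1, extended by A_Δ, bounds the left side
  lhs≤rhs : f G (suc d) (suc (suc u)) A ≤∞ fin c +∞ minList (map previous (allSubsets G (n G)))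
  lhs≤rhs = minList-greatest+ c previous (allSubsets G (n G)) λ {X} _ →
    f-greatest+ d (suc u) (X ∷ init A) c λ S' F' →
      subst (λ k → f G (suc d) (suc (suc u)) A ≤∞ fin k)
            (trans (card-∷ʳ S' (last A)) (+-comm _ c))
            (f-≤ d (suc (suc u)) A (S' ∷ʳ last A) (feasible-∷ʳ A X S' cover F'))

  -- every feasible vector for t is a feasible vector for t - 1 extended by A_Δ
  rhs≤feasible : ∀ S → Feasible d (suc (suc u)) A S →
                 fin c +∞ minList (map previous (allSubsets G (n G))) ≤∞ fin (0 + card G S)
  rhs≤feasible S F with initLast S
  ... | S' , x , refl with feasible-init A S' x F
  ... | refl , F' =
    ≤∞-trans (+∞-monoʳ c (minList-lower previous (allSubsets G (n G)) (subsets-complete (n G) X)))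
             (subst (λ k → fin c +∞ previous X ≤∞ fin k)
                    (trans (+-comm c _) (sym (card-∷ʳ S' x)))
                    (+∞-monoʳ c (f-≤ d (suc u) (X ∷ init A) S' F')))
    where X = at G S' (suc u)

  rhs≤lhs : fin c +∞ minList (map previous (allSubsets G (n G))) ≤∞ f G (suc d) (suc (suc u)) A
  rhs≤lhs = subst (fin c +∞ minList (map previous (allSubsets G (n G))) ≤∞_) (+∞-identityˡ _) (f-greatest+ d (suc (suc u)) A 0 rhs≤feasible)
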